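{- Let $\mathcal S=(\omega+3,\to,\|\cdot\|)$ be the model on the ordinals $<\omega+3$ with $\alpha\to\beta$ iff ($\alpha>\beta$) or ($\alpha=\beta$ and $\alpha$ is odd) or ($\alpha=\omega+1$ and $\beta=\omega+2$), with $\|p\|=\{\alpha:\alpha\text{ odd}\}$ and $\|q\|=\varnothing$ for every other variable $q$. Then for every formula $\varphi\in\mathcal L_{\Diamond^\infty}$ there is $n_\varphi<\omega$ such that for all $\alpha,\beta$ with $n_\varphi<\alpha,\beta<\omega+3$ which are either both even or both odd, $\alpha\in\|\varphi\|$ iff $\beta\in\|\varphi\|$.
   Context: Parity below $\omega+3$: natural numbers as usual, $\omega$ and $\omega+2$ even, $\omega+1$ odd. Semantics: $\|\Diamond\varphi\|=\{\alpha:\exists\beta(\alpha\to\beta\in\|\varphi\|)\}$, Booleans as usual, $\|\nu x.\varphi\|$ is the greatest fixed point of $X\mapsto\|\varphi\|_{x:=X}$. For finite $\Gamma$, $\Diamond^\infty\Gamma=\nu x.\bigwedge_{\gamma\in\Gamma}\Diamond(x\wedge\gamma)$. $\mathcal L_{\Diamond^\infty}$ is the language generated from $\top$ and propositional variables by $\neg$, $\wedge$, $\Diamond$ and $\Diamond^\infty\Gamma$ for finite sets $\Gamma$ of its formulas. -}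

module Defs where

open import Level using (Level; _⊔_) renaming (zero to lzero; suc to lsuc)
open import Data.Nat using (ℕ; zero; suc; _<_)
open import Data.Bool using (Bool; true; false; not)
open import Data.List using (List; []; _∷_)
open import Data.Product using (Σ; _×_; _,_)
open import Data.Sum using (_⊎_)
open import Data.Empty using (⊥)
open import Data.Unit.Polymorphic using (⊤)
open import Relation.Nullary using (¬_)
open import Relation.Binary.PropositionalEquality using (_≡_)

data Ord : Set where
  fin : ℕ → Ord
  ω   : Ord
  ω+1 : Ord
  ω+2 : Ord

_<ₒ_ : Ord → Ord → Set
fin m <ₒ fin n = m < n
fin m <ₒ ω     = ⊤
fin m <ₒ ω+1   = ⊤
fin m <ₒ ω+2   = ⊤
ω     <ₒ ω+1   = ⊤
ω     <ₒ ω+2   = ⊤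
ω+1   <ₒ ω+2   = ⊤
_     <ₒ _     = ⊥

oddℕ : ℕ → Bool
oddℕ zero    = false
oddℕ (suc n) = not (oddℕ n)

odd : Ord → Bool
odd (fin n) = oddℕ n
odd ω       = false
odd ω+1     = true
odd ω+2     = false

_⇒_ : Ord → Ord → Set
α ⇒ β = (β <ₒ α) ⊎ ((α ≡ β) × (odd α ≡ true)) ⊎ ((α ≡ ω+1) × (β ≡ ω+2))

-- the language L_{◇∞}; propositional variables indexed by ℕ, p = var 0;
-- finite sets Γ represented by lists
data Form : Set where
  ⊤f   : Form
  var  : ℕ → Form
  ¬f   : Form → Form
  _∧f_ : Form → Form → Form
  ◇    : Form → Form
  ◇∞   : List Form → Form

mutual
  lvl : Form → Level
  lvl ⊤f       = lzero
  lvl (var _)  = lzero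
  lvl (¬f φ)   = lvl φ
  lvl (φ ∧f ψ) = lvl φ ⊔ lvl ψ
  lvl (◇ φ)    = lvl φ
  lvl (◇∞ Γ)   = lsuc (lvlL Γ)

  lvlL : List Form → Level
  lvlL []      = lzero
  lvlL (γ ∷ Γ) = lvl γ ⊔ lvlL Γ

val : ℕ → Ord → Set
val zero    α = odd α ≡ true
val (suc _) α = ⊥

-- truth sets ‖φ‖ in S.  ‖◇∞Γ‖ = ν x. ⋀_{γ∈Γ} ◇(x ∧ γ), given (Knaster–Tarski)
-- as the union of all post-fixed points X ⊆ F(X).
mutual
  ⟦_⟧ : (φ : Form) → Ord → Set (lvl φ)
  ⟦ ⊤f ⟧     α = ⊤
  ⟦ var i ⟧  α = val i α
  ⟦ ¬f φ ⟧   α = ¬ ⟦ φ ⟧ α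
  ⟦ φ ∧f ψ ⟧ α = ⟦ φ ⟧ α × ⟦ ψ ⟧ α
  ⟦ ◇ φ ⟧    α = Σ Ord λ β → (α ⇒ β) × ⟦ φ ⟧ β
  ⟦ ◇∞ Γ ⟧   α = Σ (Ord → Set (lvlL Γ)) λ X → X α × (∀ β → X β → Step Γ X β)

  Step : (Γ : List Form) {ℓ : Level} (X : Ord → Set ℓ) → Ord → Set (ℓ ⊔ lvlL Γ)
  Step []      X β = ⊤
  Step (γ ∷ Γ) X β = (Σ Ord λ δ → (β ⇒ δ) × X δ × ⟦ γ ⟧ δ) × Step Γ X β

-- For ◇φ and ◇∞Γ the threshold can be chosen so that, once true somewhere, they are true at every
-- large point. For ◇φ: a large point sees every small finite ordinal, and by the induction hypothesis
-- a φ-witness can be moved, keeping its parity, to a small finite ordinal. For ◇∞Γ: ⇒ strictly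
-- decreases from even points, so every ⇒-serial set contains an odd point, and hence each γ ∈ Γ holds
-- at an odd point of the post-fixed set. Adding all large points keeps the set post-fixed: such a
-- γ-witness is either small, hence seen by every large point, or large and odd, and then γ also holds
-- at the least large odd point, which every large point sees (that point sees itself).
module Submission where

open import Defs
open import Data.Nat using (ℕ; zero; suc; _<_; _≤_) renaming (_⊔_ to _⊔ₙ_)
open import Data.Nat.Induction using (<-wellFounded)
open import Data.Nat.Properties
  using (≤-trans; ≤-<-trans; ≤-refl; n≤1+n; m≤m⊔n; m≤n⊔m; _≤?_; ≰⇒>; m≤n⇒m<n∨m≡n)
open import Data.Bool using (true; false; not; _≟_)
open import Data.Bool.Properties using (¬-not)
open import Data.Product using (Σ; _×_; _,_)
open import Data.Product.Function.NonDependent.Propositional using (_×-⇔_)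
open import Data.Sum using (_⊎_; inj₁; inj₂)
open import Data.List using (List; []; _∷_)
open import Data.List.Membership.Propositional using (_∈_)
open import Data.List.Relation.Unary.Any using (here; there)
open import Data.Unit.Polymorphic using (⊤; tt)
open import Function.Bundles using (_⇔_; mk⇔; Equivalence)
open import Function.Related.TypeIsomorphisms using (¬-cong-⇔)
open import Induction.WellFounded using (WellFounded; Acc; acc)
open import Level using (Level; _⊔_)
open import Relation.Nullary using (yes; no)
open import Relation.Binary.PropositionalEquality using (_≡_; refl; sym; trans; cong; ≢-sym)

private
  variable
    ℓ : Level

fin-≤-<ₒ : ∀ {m n} α → m ≤ n → fin n <ₒ α → fin m <ₒ α
fin-≤-<ₒ (fin _) m≤n n<k = ≤-<-trans m≤n n<k
fin-≤-<ₒ ω       _   _   = tt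
fin-≤-<ₒ ω+1     _   _   = tt
fin-≤-<ₒ ω+2     _   _   = tt

≤-fin-or-fin-<ₒ : ∀ n α → (Σ ℕ λ k → α ≡ fin k × k ≤ n) ⊎ fin n <ₒ α
≤-fin-or-fin-<ₒ n (fin k) with k ≤? n
... | yes k≤n = inj₁ (k , refl , k≤n)
... | no  k≰n = inj₂ (≰⇒> k≰n)
≤-fin-or-fin-<ₒ n ω   = inj₂ tt
≤-fin-or-fin-<ₒ n ω+1 = inj₂ tt
≤-fin-or-fin-<ₒ n ω+2 = inj₂ tt

fin-acc : ∀ {n} → Acc _<_ n → Acc _<ₒ_ (fin n)
fin-acc (acc rs) = acc λ { {fin _} m<n → fin-acc (rs m<n) ; {ω} () ; {ω+1} () ; {ω+2} () }

ω-acc : Acc _<ₒ_ ω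
ω-acc = acc λ { {fin m} _ → fin-acc (<-wellFounded m) ; {ω} () ; {ω+1} () ; {ω+2} () }

ω+1-acc : Acc _<ₒ_ ω+1
ω+1-acc = acc λ { {fin m} _ → fin-acc (<-wellFounded m) ; {ω} _ → ω-acc ; {ω+1} () ; {ω+2} () }

<ₒ-wellFounded : WellFounded _<ₒ_
<ₒ-wellFounded (fin n) = fin-acc (<-wellFounded n)
<ₒ-wellFounded ω       = ω-acc
<ₒ-wellFounded ω+1     = ω+1-acc
<ₒ-wellFounded ω+2     = acc λ
  { {fin m} _ → fin-acc (<-wellFounded m) ; {ω} _ → ω-acc ; {ω+1} _ → ω+1-acc ; {ω+2} () }

parity-between : ∀ n b → Σ ℕ λ m → n ≤ m × m ≤ suc n × oddℕ m ≡ b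
parity-between n b with oddℕ n ≟ b
... | yes n≡b = n , ≤-refl , n≤1+n n , n≡b
... | no  n≢b = suc n , n≤1+n n , ≤-refl , sym (¬-not (≢-sym n≢b))

even-⇒-<ₒ : ∀ {α β} → odd α ≡ false → α ⇒ β → β <ₒ α
even-⇒-<ₒ _  (inj₁ β<α)                 = β<α
even-⇒-<ₒ ev (inj₂ (inj₁ (refl , od))) with trans (sym ev) od
... | ()
even-⇒-<ₒ () (inj₂ (inj₂ (refl , _)))

odd-fin-⇒ : ∀ {m} α → oddℕ (suc m) ≡ true → fin m <ₒ α → α ⇒ fin (suc m)
odd-fin-⇒ (fin k) od m<k with m≤n⇒m<n∨m≡n m<k
... | inj₁ 1+m<k = inj₁ 1+m<k
... | inj₂ refl  = inj₂ (inj₁ (refl , od))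
odd-fin-⇒ ω   _ _ = inj₁ tt
odd-fin-⇒ ω+1 _ _ = inj₁ tt
odd-fin-⇒ ω+2 _ _ = inj₁ tt

Serial : (Ord → Set ℓ) → Set ℓ
Serial S = ∀ {α} → S α → Σ Ord λ β → (α ⇒ β) × S β

serial-has-odd : {S : Ord → Set ℓ} → Serial S → ∀ {α} → S α → Σ Ord λ β → S β × odd β ≡ true
serial-has-odd {S = S} serial {α} = go α (<ₒ-wellFounded α)
  where
  go : ∀ α → Acc _<ₒ_ α → S α → Σ Ord λ β → S β × odd β ≡ true
  go α (acc rs) s with odd α in parity
  ... | true  = α , s , parity
  ... | false with serial s
  ...   | β , α⇒β , s′ = go β (rs (even-⇒-<ₒ parity α⇒β)) s′

Witness : (γ : Form) → (Ord → Set ℓ) → Ord → Set (ℓ ⊔ lvl γ)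
Witness γ X α = Σ Ord λ β → (α ⇒ β) × X β × ⟦ γ ⟧ β

Step-lookup : ∀ Γ {X : Ord → Set ℓ} {α γ} → Step Γ X α → γ ∈ Γ → Witness γ X α
Step-lookup (_ ∷ _) (w , _) (here refl) = w
Step-lookup (_ ∷ Γ) (_ , s) (there γ∈Γ) = Step-lookup Γ s γ∈Γ

Step-tabulate : ∀ Γ {X : Ord → Set ℓ} {α} → (∀ {γ} → γ ∈ Γ → Witness γ X α) → Step Γ X α
Step-tabulate []      w = tt
Step-tabulate (_ ∷ Γ) w = w (here refl) , Step-tabulate Γ (λ γ∈Γ → w (there γ∈Γ))

Step-map : ∀ {ℓ′} Γ {X : Ord → Set ℓ} {Y : Ord → Set ℓ′} {α α′} →
           (∀ {β} → α ⇒ β → α′ ⇒ β) → (∀ {β} → X β → Y β) → Step Γ X α → Step Γ Y α′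
Step-map []      f g _                     = tt
Step-map (_ ∷ Γ) f g ((β , r , x , h) , s) = (β , f r , g x , h) , Step-map Γ f g s

PostFixed : (Γ : List Form) → (Ord → Set ℓ) → Set (ℓ ⊔ lvlL Γ)
PostFixed Γ X = ∀ α → X α → Step Γ X α

postFixed-odd-witness : ∀ Γ {X : Ord → Set ℓ} → PostFixed Γ X → ∀ {α γ} → X α → γ ∈ Γ →
                        Σ Ord λ β → (X β × ⟦ γ ⟧ β) × odd β ≡ true
postFixed-odd-witness Γ post xα γ∈Γ with Step-lookup Γ (post _ xα) γ∈Γ
... | _ , _ , witness = serial-has-odd (λ (x , _) → Step-lookup Γ (post _ x) γ∈Γ) witness

Good : (φ : Form) → ℕ → Set (lvl φ)
Good φ n = ∀ α β → fin n <ₒ α → fin n <ₒ β → odd α ≡ odd β → (⟦ φ ⟧ α ⇔ ⟦ φ ⟧ β)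

GoodAll : (Γ : List Form) → ℕ → Set (lvlL Γ)
GoodAll []      n = ⊤
GoodAll (γ ∷ Γ) n = Good γ n × GoodAll Γ n

good-mono : ∀ φ {m n} → m ≤ n → Good φ m → Good φ n
good-mono φ m≤n g α β n<α n<β = g α β (fin-≤-<ₒ α m≤n n<α) (fin-≤-<ₒ β m≤n n<β)

goodAll-mono : ∀ Γ {m n} → m ≤ n → GoodAll Γ m → GoodAll Γ n
goodAll-mono []      _   _        = tt
goodAll-mono (γ ∷ Γ) m≤n (g , gs) = good-mono γ m≤n g , goodAll-mono Γ m≤n gs

goodAll-lookup : ∀ {Γ n γ} → GoodAll Γ n → γ ∈ Γ → Good γ n
goodAll-lookup (g , _)  (here refl) = g
goodAll-lookup (_ , gs) (there γ∈Γ) = goodAll-lookup gs γ∈Γ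

good-transport : ∀ φ {n α β} → Good φ n → fin n <ₒ α → fin n <ₒ β → odd α ≡ odd β →
                 ⟦ φ ⟧ α → ⟦ φ ⟧ β
good-transport φ g n<α n<β same = Equivalence.to (g _ _ n<α n<β same)

good-if-spreading : ∀ φ {n} → (∀ {α β} → fin n <ₒ β → ⟦ φ ⟧ α → ⟦ φ ⟧ β) → Good φ n
good-if-spreading φ spread α β n<α n<β _ = mk⇔ (spread n<β) (spread n<α)

good-¬ : ∀ φ {n} → Good φ n → Good (¬f φ) n
good-¬ φ g α β n<α n<β same = ¬-cong-⇔ (g α β n<α n<β same)

good-∧ : ∀ φ ψ {m n} → Good φ m → Good ψ n → Good (φ ∧f ψ) (m ⊔ₙ n)
good-∧ φ ψ {m} {n} g h α β n<α n<β same =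
  good-mono φ (m≤m⊔n m n) g α β n<α n<β same ×-⇔ good-mono ψ (m≤n⊔m m n) h α β n<α n<β same

good-small-fin : ∀ φ {n α} → Good φ n → ⟦ φ ⟧ α → Σ ℕ λ k → k ≤ suc (suc n) × ⟦ φ ⟧ (fin k)
good-small-fin φ {n} {α} g h with ≤-fin-or-fin-<ₒ n α
... | inj₁ (k , refl , k≤n) = k , ≤-trans k≤n (≤-trans (n≤1+n n) (n≤1+n (suc n))) , h
... | inj₂ n<α with parity-between (suc n) (odd α)
...   | t , n<t , t≤2+n , parity = t , t≤2+n , good-transport φ g n<α n<t (sym parity) h

◇-spreading : ∀ φ {n α β} → Good φ n → fin (suc (suc n)) <ₒ β → ⟦ ◇ φ ⟧ α → ⟦ ◇ φ ⟧ β
◇-spreading φ {β = β} g 2+n<β (_ , _ , h) with good-small-fin φ g h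
... | k , k≤2+n , hk = fin k , inj₁ (fin-≤-<ₒ β k≤2+n 2+n<β) , hk

-- The large ordinals are those above m; the odd one among them, m + 1, is seen by all of them.
◇∞-spreading : ∀ Γ {n m α β} → GoodAll Γ n → n ≤ m → oddℕ (suc m) ≡ true →
               fin m <ₒ β → ⟦ ◇∞ Γ ⟧ α → ⟦ ◇∞ Γ ⟧ β
◇∞-spreading Γ {n} {m} gs n≤m od m<β (X , xα , post) = Large , inj₂ m<β , post′
  where
  Large : Ord → Set (lvlL Γ)
  Large δ = X δ ⊎ fin m <ₒ δ

  witness : ∀ {δ γ} → fin m <ₒ δ → γ ∈ Γ → Witness γ Large δ
  witness {δ} {γ} m<δ γ∈Γ with postFixed-odd-witness Γ post xα γ∈Γ
  ... | ε , (xε , hε) , oddε with ≤-fin-or-fin-<ₒ n ε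
  ...   | inj₁ (k , refl , k≤n) = fin k , inj₁ (fin-≤-<ₒ δ (≤-trans k≤n n≤m) m<δ) , inj₁ xε , hε
  ...   | inj₂ n<ε =
          fin (suc m) , odd-fin-⇒ δ od m<δ , inj₂ ≤-refl ,
          good-transport γ (goodAll-lookup gs γ∈Γ) n<ε (≤-<-trans n≤m ≤-refl) (trans oddε (sym od)) hε

  post′ : PostFixed Γ Large
  post′ _ (inj₁ x)   = Step-map Γ (λ r → r) inj₁ (post _ x)
  post′ _ (inj₂ m<δ) = Step-tabulate Γ (witness m<δ)

mutual
  good : (φ : Form) → Σ ℕ (Good φ)
  good ⊤f            = 0 , λ _ _ _ _ _ → mk⇔ (λ _ → tt) (λ _ → tt)
  good (var zero)    = 0 , λ _ _ _ _ same → mk⇔ (trans (sym same)) (trans same)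
  good (var (suc _)) = 0 , λ _ _ _ _ _ → mk⇔ (λ ()) (λ ())
  good (¬f φ) with good φ
  ... | n , g = n , good-¬ φ g
  good (φ ∧f ψ) with good φ | good ψ
  ... | m , g | n , h = m ⊔ₙ n , good-∧ φ ψ g h
  good (◇ φ) with good φ
  ... | n , g = suc (suc n) , good-if-spreading (◇ φ) (◇-spreading φ g)
  good (◇∞ Γ) with goodAll Γ
  ... | n , gs with parity-between n false
  ...   | m , n≤m , m≤1+n , even = suc n , good-if-spreading (◇∞ Γ) λ {_} {β} 1+n<β →
          ◇∞-spreading Γ gs n≤m (cong not even) (fin-≤-<ₒ β m≤1+n 1+n<β)

  goodAll : (Γ : List Form) → Σ ℕ (GoodAll Γ)
  goodAll []      = 0 , tt
  goodAll (γ ∷ Γ) with good γ | goodAll Γ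
  ... | m , g | n , gs = m ⊔ₙ n , good-mono γ (m≤m⊔n m n) g , goodAll-mono Γ (m≤n⊔m m n) gs

mainTheorem6 : (φ : Form) → Σ ℕ λ n → ∀ α β → fin n <ₒ α → fin n <ₒ β →
    odd α ≡ odd β → (⟦ φ ⟧ α ⇔ ⟦ φ ⟧ β)
mainTheorem6 = good
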